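{- Let $\mathbb{F}$ be a field of characteristic zero, let $J\ge 0$ be an integer, and let $k,r,\ell$ be positive integers with $r\ge 2$ and $1\le \ell\le r$. Then for every odd integer $k\ge 2J+1$, $$\mathrm{HP}^{k}_{\ell}=\sum_{j=1}^{\ell-1} q^{(k+1)j-1}\,\mathrm{HP}^{k+2}_{r-j+1}+\sum_{j=1}^{\ell} q^{(k+1)(j-1)}\,\mathrm{HP}^{k+2}_{r-j+1}.$$
   Context: For an integer $k\ge1$ let $S_k=\mathbb{F}[x_k,x_{k+1},x_{k+2},\ldots]$, graded by weight, where the monomial $x_{i_1}^{\alpha_1}\cdots x_{i_m}^{\alpha_m}$ has weight $\sum_t i_t\alpha_t$. For a homogeneous ideal $I$ of $S_k$, the Hilbert–Poincaré series is $\mathrm{HP}(S_k/I)=\sum_{j\ge0}\dim_{\mathbb{F}}(S_k/I)_j\,q^j\in\mathbb{Z}[[q]]$, where $(S_k/I)_j$ is the degree-$j$ (weight-$j$) component. Fix $r\ge2$. Define the monomial ideal $$L_k=\big(x_{2a-1}^2,\ x_{2b-1}x_{2b}^{r-1},\ x_{2c}^{r-n_1}x_{2c+2}^{n_1},\ x_{2c}^{r-n_2-1}x_{2c+1}x_{2c+2}^{n_2}\ :\ a,b,c\in\mathbb{Z},\ 2a-1,2b-1,2c\ge k,\ 0\le n_1\le r-1,\ 0\le n_2\le r-2\big)\subseteq S_k,$$ and for $1\le \ell\le r$ define $L_k^{\ell}\subseteq S_k$ by: if $k$ is even, $$L_k^{\ell}=\big(x_k^{\ell},\ x_k^{\ell-t}x_{k+2}^{r-\ell+t}\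 (1\le t\le \ell-1),\ x_k^{\ell-t}x_{k+1}x_{k+2}^{r-\ell+t-1}\ (1\le t\le \ell-1),\ L_{k+1}\big);$$ if $k$ is odd, $L_k^{\ell}=\big(x_k^2,\ x_kx_{k+1}^{\ell-1},\ L_{k+1}^{\ell}\big)$ (generators of ideals of $S_{k+1}$ regarded in $S_k$). Write $\mathrm{HP}^k=\mathrm{HP}(S_k/L_k)$ and $\mathrm{HP}^k_{\ell}=\mathrm{HP}(S_k/L_k^{\ell})$. -}

module Defs where

open import Data.Nat using (ℕ; zero; suc; _+_; _*_; _∸_; _≤_; _≡ᵇ_; _%_)
open import Data.Bool using (if_then_else_)
open import Data.List using (List; []; _∷_; length)
open import Data.Nat.ListAction using (sum)
open import Data.List.Relation.Unary.All using (All)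
open import Data.List.Relation.Unary.Linked using (Linked)
open import Data.List.Relation.Unary.Unique.Propositional using (Unique)
open import Data.List.Membership.Propositional using (_∈_)
open import Data.Product using (Σ; ∃; _×_)
open import Relation.Nullary using (¬_)
open import Relation.Nullary.Decidable using (⌊_⌋)
open import Relation.Binary.PropositionalEquality using (_≡_)
open import Data.Nat using (_≟_)
open import Function.Bundles using (_⇔_)

-- Monomials of S_k = F[x_k, x_{k+1}, ...].
-- A monomial x_{i_1} x_{i_2} ... x_{i_m} (with repetitions, i_1 ≤ ... ≤ i_m)
-- is represented canonically by the nondecreasing list [i_1, ..., i_m] of
-- its variable indices, all ≥ k.

IsMon : ℕ → List ℕ → Set
IsMon k xs = Linked _≤_ xs × All (k ≤_) xs

weight : List ℕ → ℕ
weight = sum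

expo : ℕ → List ℕ → ℕ
expo v []       = 0
expo v (i ∷ xs) = (if i ≡ᵇ v then 1 else 0) + expo v xs

-- Exponent vectors (used to write down generators of monomial ideals).

Exp : Set
Exp = ℕ → ℕ

xp : ℕ → ℕ → Exp
xp i a v = if v ≡ᵇ i then a else 0

_⊗_ : Exp → Exp → Exp
(e ⊗ f) v = e v + f v
infixl 7 _⊗_

Divides : Exp → List ℕ → Set
Divides e xs = ∀ v → e v ≤ expo v xs

InIdeal : (Exp → Set) → List ℕ → Set
InIdeal Gen xs = ∃ λ e → Gen e × Divides e xs

-- Generators of L_k  (r fixed).  Odd indices 2a-1 (a ≥ 1) are written
-- suc (2 * a') with a' = a - 1 ≥ 0; even indices 2c ≥ k ≥ 1 as 2 * c.

data LGen (r k : ℕ) : Exp → Set where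
  g-sq   : ∀ a → k ≤ suc (2 * a) → LGen r k (xp (suc (2 * a)) 2)
  g-odd  : ∀ b → k ≤ suc (2 * b) →
           LGen r k (xp (suc (2 * b)) 1 ⊗ xp (2 + 2 * b) (r ∸ 1))
  g-ev1  : ∀ c n₁ → k ≤ 2 * c → n₁ ≤ r ∸ 1 →
           LGen r k (xp (2 * c) (r ∸ n₁) ⊗ xp (2 + 2 * c) n₁)
  g-ev2  : ∀ c n₂ → k ≤ 2 * c → n₂ ≤ r ∸ 2 →
           LGen r k (xp (2 * c) ((r ∸ n₂) ∸ 1) ⊗ xp (suc (2 * c)) 1
                     ⊗ xp (2 + 2 * c) n₂)

data LGenEven (r ℓ k : ℕ) : Exp → Set where
  e-pow  : LGenEven r ℓ k (xp k ℓ)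
  e-t1   : ∀ t → 1 ≤ t → t ≤ ℓ ∸ 1 →
           LGenEven r ℓ k (xp k (ℓ ∸ t) ⊗ xp (2 + k) ((r ∸ ℓ) + t))
  e-t2   : ∀ t → 1 ≤ t → t ≤ ℓ ∸ 1 →
           LGenEven r ℓ k (xp k (ℓ ∸ t) ⊗ xp (suc k) 1
                           ⊗ xp (2 + k) (((r ∸ ℓ) + t) ∸ 1))
  e-L    : ∀ {e} → LGen r (suc k) e → LGenEven r ℓ k e

data LGenOdd (r ℓ k : ℕ) : Exp → Set where
  o-sq   : LGenOdd r ℓ k (xp k 2)
  o-mix  : LGenOdd r ℓ k (xp k 1 ⊗ xp (suc k) (ℓ ∸ 1))
  o-L    : ∀ {e} → LGenEven r ℓ (suc k) e → LGenOdd r ℓ k e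

LGenℓ : ℕ → ℕ → ℕ → Exp → Set
LGenℓ r ℓ k = if k % 2 ≡ᵇ 0 then LGenEven r ℓ k else LGenOdd r ℓ k

-- A power series is its coefficient function
-- ℕ → ℕ.  For a monomial ideal I (given by generators Gen) of S_k, the
-- monomials not in I form an F-basis of S_k/I, so dim (S_k/I)_n is the
-- number of monomials of weight n not in I.  "IsHP k Gen h" says that h
-- is HP(S_k/I): for every n there is a duplicate-free list of exactly
-- h n elements listing precisely the weight-n monomials of S_k not in I.

IsHP : ℕ → (Exp → Set) → (ℕ → ℕ) → Set
IsHP k Gen h = ∀ n → ∃ λ (ms : List (List ℕ)) →
  Unique ms × length ms ≡ h n ×
  (∀ xs → (xs ∈ ms) ⇔ (IsMon k xs × weight xs ≡ n × ¬ InIdeal Gen xs))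

-- coefficient at q^n of q^s · f
shift : ℕ → (ℕ → ℕ) → ℕ → ℕ
shift s f n = if s Data.Nat.≤ᵇ n then f (n ∸ s) else 0

sum1 : ℕ → (ℕ → ℕ) → ℕ
sum1 zero    f = 0
sum1 (suc m) f = sum1 m f + f (suc m)

Odd : ℕ → Set
Odd k = ∃ λ m → k ≡ suc (2 * m)

{-# OPTIONS --safe #-}
-- Every monomial of S_k factors uniquely as x_k^a x_{k+1}^b y with y in S_{k+2}.  It lies in L_k^ℓ
-- as soon as a ≥ 2 or b ≥ ℓ - a (then x_k^2, x_k x_{k+1}^(ℓ-1) or x_{k+1}^ℓ divides it), and for
-- a ≤ 1, b < ℓ - a it lies in L_k^ℓ iff y lies in L_{k+2}^(r-b): x_{k+1}^b times a generator of
-- L_{k+2}^(r-b) is a multiple of a generator of L_{k+1}^ℓ, and conversely a generator of L_k^ℓ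
-- dividing x_k^a x_{k+1}^b y either leaves a generator of L_{k+2}^(r-b) dividing y or is a generator
-- of L_{k+2} ⊆ L_{k+2}^(r-b).  So the standard monomials of weight n fall into blocks indexed by
-- (a, b), the block (a, b) being counted by q^(ak+(k+1)b) HP^{k+2}_{r-b}; the blocks with a = 1 give
-- the first sum and those with a = 0 the second, with j = b + 1.
module Submission where

open import Defs
open import Data.Nat using (ℕ; zero; suc; _+_; _*_; _∸_; _≤_; _<_; _≤ᵇ_; _≡ᵇ_; z≤n; s≤s; s≤s⁻¹)
open import Data.Nat.Properties
open import Data.Nat.DivMod using (_%_; [m+kn]%n≡m%n)
open import Data.Nat.ListAction using (sum)
open import Data.Nat.ListAction.Properties using (sum-++)
open import Data.Nat.Tactic.RingSolver using (solve-∀)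
open import Data.Bool using (true; false; T)
open import Data.Unit using (tt)
open import Data.List using (List; []; _∷_; _++_; length; map; replicate)
open import Data.List.Properties using (length-++; length-map; ++-cancelˡ)
open import Data.List.Membership.Propositional using (_∈_)
open import Data.List.Membership.Propositional.Properties using (∈-map⁺; ∈-map⁻; ++-∈⇔)
open import Data.List.Membership.Propositional.Properties.WithK using (unique∧set⇒bag)
open import Data.List.Relation.Binary.BagAndSetEquality using (∼bag⇒↭)
open import Data.List.Relation.Binary.Permutation.Propositional.Properties using (↭-length)
open import Data.List.Relation.Unary.All as All using (All; []; _∷_)
open import Data.List.Relation.Unary.AllPairs using ([])
open import Data.List.Relation.Unary.Linked as Linked using (Linked; []; [-]; _∷_)
open import Data.List.Relation.Unary.Linked.Properties using (Linked⇒All)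
open import Data.List.Relation.Unary.Unique.Propositional using (Unique)
import Data.List.Relation.Unary.Unique.Propositional.Properties as Unique
open import Data.Product using (∃; ∃₂; _×_; _,_; proj₁; proj₂)
open import Data.Sum using (_⊎_; inj₁; inj₂)
open import Data.Sum.Function.Propositional using (_⊎-⇔_)
open import Data.Empty using (⊥)
open import Function.Base using (_∘_)
open import Function.Bundles using (_⇔_; mk⇔; Equivalence)
open import Function.Properties.Equivalence using () renaming (sym to ⇔-sym; trans to ⇔-trans)
open import Relation.Nullary using (¬_; contradiction; yes; no)
open import Relation.Nullary.Reflects using (ofʸ; ofⁿ)
open import Relation.Binary.PropositionalEquality

open Equivalence using (to; from)

private variable
  A : Set
  P Q : A → Set
  a b c d i k m n r t v w y ℓ : ℕ
  e e′ f f′ g : Exp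
  G G′ : Exp → Set
  xs ys zs : List ℕ

HasCount : (A → Set) → ℕ → Set
HasCount P c = ∃ λ xs → Unique xs × length xs ≡ c × (∀ x → x ∈ xs ⇔ P x)

HasCount-unique : HasCount P c → HasCount P d → c ≡ d
HasCount-unique (xs , xs! , refl , xs⇔P) (ys , ys! , refl , ys⇔P) =
  ↭-length (∼bag⇒↭ (unique∧set⇒bag xs! ys! λ {x} → ⇔-trans (xs⇔P x) (⇔-sym (ys⇔P x))))

HasCount-cong : (∀ x → P x ⇔ Q x) → HasCount P c → HasCount Q c
HasCount-cong P⇔Q (xs , xs! , len , xs⇔P) = xs , xs! , len , λ x → ⇔-trans (xs⇔P x) (P⇔Q x)

HasCount-⊎ : (∀ x → P x → Q x → ⊥) → HasCount P c → HasCount Q d →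
             HasCount (λ x → P x ⊎ Q x) (c + d)
HasCount-⊎ P∩Q=∅ (xs , xs! , refl , xs⇔P) (ys , ys! , refl , ys⇔Q) =
  xs ++ ys ,
  Unique.++⁺ xs! ys! (λ {x} (x∈xs , x∈ys) →
    P∩Q=∅ x (to (xs⇔P x) x∈xs) (to (ys⇔Q x) x∈ys)) ,
  length-++ xs ,
  λ x → ⇔-trans ++-∈⇔ (xs⇔P x ⊎-⇔ ys⇔Q x)

HasCount-image : ∀ {B : Set} {f : A → B} → (∀ {x y} → f x ≡ f y → x ≡ y) →
                 HasCount P c → HasCount (λ y → ∃ λ x → P x × y ≡ f x) c
HasCount-image {f = f} f-inj (xs , xs! , refl , xs⇔P) =
  map f xs , Unique.map⁺ f-inj xs! , length-map f xs ,
  λ y → mk⇔ (λ y∈ → let x , x∈xs , y≡fx = ∈-map⁻ f y∈ in x , to (xs⇔P x) x∈xs , y≡fx)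
            (λ { (x , Px , refl) → ∈-map⁺ f (from (xs⇔P x) Px) })

HasCount-shift : ∀ {Q : ℕ → A → Set} {h : ℕ → ℕ} → (∀ w → HasCount (Q w) (h w)) →
                 ∀ s n → HasCount (λ x → s ≤ n × Q (n ∸ s) x) (shift s h n)
HasCount-shift count s n with s ≤ᵇ n | ≤ᵇ-reflects-≤ s n
... | true  | ofʸ s≤n = let xs , xs! , len , xs⇔Q = count (n ∸ s) in
  xs , xs! , len ,
  λ x → mk⇔ (λ x∈xs → s≤n , to (xs⇔Q x) x∈xs) (λ (_ , Qx) → from (xs⇔Q x) Qx)
... | false | ofⁿ s≰n =
  [] , [] , refl , λ x → mk⇔ (λ ()) (λ (s≤n , _) → contradiction s≤n s≰n)

HasCount-sum1 : ∀ {P : ℕ → A → Set} {f : ℕ → ℕ} m →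
                (∀ {b b′ x} → P b x → P b′ x → b ≡ b′) →
                (∀ b → b < m → HasCount (P b) (f (suc b))) →
                HasCount (λ x → ∃ λ b → b < m × P b x) (sum1 m f)
HasCount-sum1 zero    _       _     = [] , [] , refl , λ x → mk⇔ (λ ()) (λ ())
HasCount-sum1 {P = P} (suc m) P-disj count =
  HasCount-cong (λ x → mk⇔ join split)
    (HasCount-⊎ (λ { x (b , b<m , Pb) Pm → <-irrefl (P-disj Pb Pm) b<m })
      (HasCount-sum1 m P-disj (λ b b<m → count b (m<n⇒m<1+n b<m)))
      (count m ≤-refl))
  where
  join : ∀ {x} → (∃ λ b → b < m × P b x) ⊎ P m x → ∃ λ b → b < suc m × P b x
  join (inj₁ (b , b<m , Pb)) = b , m<n⇒m<1+n b<m , Pb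
  join (inj₂ Pm)             = m , ≤-refl , Pm
  split : ∀ {x} → (∃ λ b → b < suc m × P b x) → (∃ λ b → b < m × P b x) ⊎ P m x
  split (b , b<1+m , Pb) with m≤n⇒m<n∨m≡n (s≤s⁻¹ b<1+m)
  ... | inj₁ b<m  = inj₁ (b , b<m , Pb)
  ... | inj₂ refl = inj₂ Pb

-- Divides e xs and InIdeal G xs of Defs are definitionally e ≼ exps xs and exps xs ∈⟨ G ⟩.
infix 4 _≼_ _∈⟨_⟩

_≼_ : Exp → Exp → Set
e ≼ f = ∀ v → e v ≤ f v

exps : List ℕ → Exp
exps xs v = expo v xs

_∈⟨_⟩ : Exp → (Exp → Set) → Set
f ∈⟨ G ⟩ = ∃ λ e → G e × e ≼ f

≼-refl : e ≼ e
≼-refl v = ≤-refl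

≼-trans : e ≼ f → f ≼ g → e ≼ g
≼-trans e≼f f≼g v = ≤-trans (e≼f v) (f≼g v)

⊗-mono-≼ : e ≼ e′ → f ≼ f′ → e ⊗ f ≼ e′ ⊗ f′
⊗-mono-≼ e≼e′ f≼f′ v = +-mono-≤ (e≼e′ v) (f≼f′ v)

e≼e⊗f : e ≼ e ⊗ f
e≼e⊗f {e} v = m≤m+n (e v) _

f≼e⊗f : f ≼ e ⊗ f
f≼e⊗f {e = e} v = m≤n+m _ (e v)

⊗-assoc-≼ : ∀ e f g → (e ⊗ f) ⊗ g ≼ e ⊗ (f ⊗ g)
⊗-assoc-≼ e f g v = ≤-reflexive (+-assoc (e v) (f v) (g v))

⊗-≼ˡ : e ⊗ f ≼ g → e ≼ g
⊗-≼ˡ e⊗f≼g = ≼-trans e≼e⊗f e⊗f≼g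

⊗-≼ʳ : e ⊗ f ≼ g → f ≼ g
⊗-≼ʳ e⊗f≼g = ≼-trans f≼e⊗f e⊗f≼g

xp-≢ : ∀ a → v ≢ i → xp i a v ≡ 0
xp-≢ {v} {i} a v≢i with v ≡ᵇ i in eq
... | false = refl
... | true  = contradiction (≡ᵇ⇒≡ v i (subst T (sym eq) tt)) v≢i

xp-self : ∀ i a → xp i a i ≡ a
xp-self i a with i ≡ᵇ i in eq
... | true  = refl
... | false = contradiction (subst T eq (≡⇒≡ᵇ i i refl)) λ ()

xp-mono-≼ : a ≤ c → xp i a ≼ xp i c
xp-mono-≼ {i = i} a≤c v with v ≡ᵇ i
... | true  = a≤c
... | false = z≤n

⊗-xp-0-≼ : e ⊗ xp i 0 ≼ e
⊗-xp-0-≼ {e} {i} v with v ≡ᵇ i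
... | true  = ≤-reflexive (+-identityʳ (e v))
... | false = ≤-reflexive (+-identityʳ (e v))

xp-≼⇒≤ : xp i a ≼ f → a ≤ f i
xp-≼⇒≤ {i} {a} {f} xp≼f = subst (_≤ f i) (xp-self i a) (xp≼f i)

≤⇒xp-≼ : a ≤ f i → xp i a ≼ f
≤⇒xp-≼ {a} {f} {i} a≤fi v with v ≟ i
... | yes refl = subst (_≤ f v) (sym (xp-self v a)) a≤fi
... | no  v≢i  = subst (_≤ f v) (sym (xp-≢ a v≢i)) z≤n

⊗-xp-≼ : e ≼ f → e i ≡ 0 → a ≤ f i → e ⊗ xp i a ≼ f
⊗-xp-≼ {e} {f} {i} {a} e≼f ei≡0 a≤fi v with v ≟ i
... | yes refl = subst (_≤ f v) (cong₂ _+_ (sym ei≡0) (sym (xp-self v a))) a≤fi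
... | no  v≢i  =
  ≤-trans (≤-reflexive (trans (cong (e v +_) (xp-≢ a v≢i)) (+-identityʳ (e v)))) (e≼f v)

∈⟨⟩-gen : G e → e ∈⟨ G ⟩
∈⟨⟩-gen Ge = _ , Ge , ≼-refl

∈⟨⟩-≼ : f ∈⟨ G ⟩ → f ≼ f′ → f′ ∈⟨ G ⟩
∈⟨⟩-≼ (e , Ge , e≼f) f≼f′ = e , Ge , ≼-trans e≼f f≼f′

∈⟨⟩-⊗ˡ : ∀ e → f ∈⟨ G ⟩ → e ⊗ f ∈⟨ G ⟩
∈⟨⟩-⊗ˡ _ f∈G = ∈⟨⟩-≼ f∈G f≼e⊗f

∈⟨⟩-map : (∀ {e} → G e → G′ e) → f ∈⟨ G ⟩ → f ∈⟨ G′ ⟩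
∈⟨⟩-map G⊆G′ (e , Ge , e≼f) = e , G⊆G′ Ge , e≼f

Above : ℕ → Exp → Set
Above w e = ∀ {v} → v < w → e v ≡ 0

xp-Above : ∀ a → w ≤ i → Above w (xp i a)
xp-Above a w≤i v<w = xp-≢ a (<⇒≢ (<-≤-trans v<w w≤i))

⊗-Above : Above w e → Above w f → Above w (e ⊗ f)
⊗-Above e↑ f↑ v<w = cong₂ _+_ (e↑ v<w) (f↑ v<w)

Even : ℕ → Set
Even i = ∃ λ c → i ≡ 2 * c

Odd⇒Even-suc : Odd i → Even (suc i)
Odd⇒Even-suc (m , refl) = suc m , sym (*-suc 2 m)

Even⇒Odd-suc : Even i → Odd (suc i)
Even⇒Odd-suc (c , refl) = c , refl

Even-2+ : Even i → Even (2 + i)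
Even-2+ = Odd⇒Even-suc ∘ Even⇒Odd-suc

Odd-2+ : Odd i → Odd (2 + i)
Odd-2+ = Even⇒Odd-suc ∘ Odd⇒Even-suc

double-gap : m < n → suc (suc (2 * m)) ≤ 2 * n
double-gap {m} {n} m<n = subst (_≤ 2 * n) (*-suc 2 m) (*-monoʳ-≤ 2 m<n)

double-≤-split : ∀ m n → 2 * m ≤ 2 * n → m ≡ n ⊎ suc (suc (2 * m)) ≤ 2 * n
double-≤-split m n 2m≤2n with m≤n⇒m<n∨m≡n (*-cancelˡ-≤ 2 2m≤2n)
... | inj₁ m<n  = inj₂ (double-gap m<n)
... | inj₂ m≡n  = inj₁ m≡n

odd<even⇒suc-odd≤even : ∀ m n → suc (2 * m) ≤ 2 * n → suc (suc (2 * m)) ≤ 2 * n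
odd<even⇒suc-odd≤even m n 2m<2n = double-gap (*-cancelˡ-< 2 m n 2m<2n)

even≤odd⇒even≤even : ∀ m n → 2 * m ≤ suc (2 * n) → 2 * m ≤ 2 * n
even≤odd⇒even≤even m n 2m≤1+2n =
  *-monoʳ-≤ 2 (s≤s⁻¹ (*-cancelˡ-< 2 m (suc n) (subst (2 * m <_) (sym (*-suc 2 n)) (s≤s 2m≤1+2n))))

odd%2≡1 : Odd i → i % 2 ≡ 1
odd%2≡1 (m , refl) = trans (cong (λ x → suc x % 2) (*-comm 2 m)) ([m+kn]%n≡m%n 1 m 2)

IsHP-odd : ∀ {h} → Odd i → IsHP i (LGenℓ r ℓ i) h → IsHP i (LGenOdd r ℓ i) h
IsHP-odd i-odd rewrite odd%2≡1 i-odd = λ hp → hp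

≤∸1⇒< : 1 ≤ n → m ≤ n ∸ 1 → m < n
≤∸1⇒< {suc n} _ m≤n = s≤s m≤n

≤∸2⇒suc< : 2 ≤ n → m ≤ n ∸ 2 → suc m < n
≤∸2⇒suc< {suc (suc n)} _ m≤n = s≤s (s≤s m≤n)
≤∸2⇒suc< {suc zero} (s≤s ()) _

[m∸n]+[n∸o]≡m∸o : ∀ {m n o} → o ≤ n → n ≤ m → (m ∸ n) + (n ∸ o) ≡ m ∸ o
[m∸n]+[n∸o]≡m∸o {m} {n} {o} o≤n n≤m =
  trans (sym (+-∸-assoc (m ∸ n) o≤n)) (cong (_∸ o) (m∸n+n≡m n≤m))

[m∸n]+o≡m∸[n∸o] : ∀ {m n o} → o ≤ n → n ≤ m → (m ∸ n) + o ≡ m ∸ (n ∸ o)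
[m∸n]+o≡m∸[n∸o] {m} {n} {o} o≤n n≤m =
  trans (cong ((m ∸ n) +_) (sym (m∸[m∸n]≡n o≤n))) ([m∸n]+[n∸o]≡m∸o (m∸n≤m n o) n≤m)

n∸o≤p⇒m∸p≤[m∸n]+o : ∀ {m n o p} → o ≤ n → n ≤ m → n ∸ o ≤ p → m ∸ p ≤ (m ∸ n) + o
n∸o≤p⇒m∸p≤[m∸n]+o {m} o≤n n≤m n∸o≤p =
  ≤-trans (∸-monoʳ-≤ m n∸o≤p) (≤-reflexive (sym ([m∸n]+o≡m∸[n∸o] o≤n n≤m)))

m+n≡o⇔m≤o×n≡o∸m : ∀ m n o → m + n ≡ o ⇔ (m ≤ o × n ≡ o ∸ m)
m+n≡o⇔m≤o×n≡o∸m m n o = mk⇔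
  (λ { refl → m≤m+n m n , sym (m+n∸m≡n m n) })
  (λ { (m≤o , refl) → m+[n∸m]≡n m≤o })

LGen-sq : Odd i → w ≤ i → LGen r w (xp i 2)
LGen-sq (a , refl) = g-sq a

LGen-odd : Odd i → w ≤ i → LGen r w (xp i 1 ⊗ xp (suc i) (r ∸ 1))
LGen-odd (b , refl) = g-odd b

LGen-ev1 : Even i → w ≤ i → n ≤ r ∸ 1 → LGen r w (xp i (r ∸ n) ⊗ xp (2 + i) n)
LGen-ev1 {n = n} (c , refl) = g-ev1 c n

LGen-ev2 : Even i → w ≤ i → n ≤ r ∸ 2 →
           LGen r w (xp i ((r ∸ n) ∸ 1) ⊗ xp (suc i) 1 ⊗ xp (2 + i) n)
LGen-ev2 {n = n} (c , refl) = g-ev2 c n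

LGen-weaken : w ≤ i → LGen r i e → LGen r w e
LGen-weaken w≤i (g-sq a p)       = g-sq a (≤-trans w≤i p)
LGen-weaken w≤i (g-odd b p)      = g-odd b (≤-trans w≤i p)
LGen-weaken w≤i (g-ev1 c n p q)  = g-ev1 c n (≤-trans w≤i p) q
LGen-weaken w≤i (g-ev2 c n p q)  = g-ev2 c n (≤-trans w≤i p) q

LGen-Above : LGen r w e → Above w e
LGen-Above (g-sq a p)      = xp-Above 2 p
LGen-Above (g-odd b p)     = ⊗-Above (xp-Above 1 p) (xp-Above _ (m≤n⇒m≤1+n p))
LGen-Above (g-ev1 c n p q) = ⊗-Above (xp-Above _ p) (xp-Above n (m≤n⇒m≤1+n (m≤n⇒m≤1+n p)))
LGen-Above (g-ev2 c n p q) =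
  ⊗-Above (⊗-Above (xp-Above _ p) (xp-Above 1 (m≤n⇒m≤1+n p)))
          (xp-Above n (m≤n⇒m≤1+n (m≤n⇒m≤1+n p)))

-- Defs indexes the mixed generators of L_i^ℓ by t; writing y = ℓ - t they are x_i^y x_{i+2}^(r-y)
-- and x_i^y x_{i+1} x_{i+2}^(r-y-1) with 1 ≤ y < ℓ.
LGenEven-t1 : ℓ ≤ r → 1 ≤ y → y < ℓ → xp i y ⊗ xp (2 + i) (r ∸ y) ∈⟨ LGenEven r ℓ i ⟩
LGenEven-t1 {ℓ} ℓ≤r 1≤y y<ℓ =
  _ , e-t1 _ (m<n⇒0<n∸m y<ℓ) (∸-monoʳ-≤ ℓ 1≤y) ,
  ⊗-mono-≼ (xp-mono-≼ (≤-reflexive (m∸[m∸n]≡n (<⇒≤ y<ℓ))))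
           (xp-mono-≼ (≤-reflexive ([m∸n]+[n∸o]≡m∸o (<⇒≤ y<ℓ) ℓ≤r)))

LGenEven-t2 : ℓ ≤ r → 1 ≤ y → y < ℓ →
              xp i y ⊗ xp (suc i) 1 ⊗ xp (2 + i) ((r ∸ y) ∸ 1) ∈⟨ LGenEven r ℓ i ⟩
LGenEven-t2 {ℓ} ℓ≤r 1≤y y<ℓ =
  _ , e-t2 _ (m<n⇒0<n∸m y<ℓ) (∸-monoʳ-≤ ℓ 1≤y) ,
  ⊗-mono-≼ (⊗-mono-≼ (xp-mono-≼ (≤-reflexive (m∸[m∸n]≡n (<⇒≤ y<ℓ)))) ≼-refl)
           (xp-mono-≼ (≤-reflexive (cong (_∸ 1) ([m∸n]+[n∸o]≡m∸o (<⇒≤ y<ℓ) ℓ≤r))))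

t-generator-in-y-form : ℓ ≤ r → 1 ≤ t → t ≤ ℓ ∸ 1 →
                        1 ≤ ℓ ∸ t × ℓ ∸ t < ℓ × (r ∸ ℓ) + t ≡ r ∸ (ℓ ∸ t)
t-generator-in-y-form {ℓ} ℓ≤r 1≤t t≤ℓ∸1 =
  m<n⇒0<n∸m t<ℓ , ∸-monoʳ-< 1≤t (<⇒≤ t<ℓ) , [m∸n]+o≡m∸[n∸o] (<⇒≤ t<ℓ) ℓ≤r
  where t<ℓ = ≤∸1⇒< (≤-trans 1≤t (≤-trans t≤ℓ∸1 (m∸n≤m ℓ 1))) t≤ℓ∸1

ev1∈LGen : Even i → w ≤ i → 1 ≤ y → y ≤ r → xp i y ⊗ xp (2 + i) (r ∸ y) ∈⟨ LGen r w ⟩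
ev1∈LGen {r = r} i-even w≤i 1≤y y≤r =
  _ , LGen-ev1 i-even w≤i (∸-monoʳ-≤ r 1≤y) ,
  ⊗-mono-≼ (xp-mono-≼ (≤-reflexive (m∸[m∸n]≡n y≤r))) ≼-refl

ev2∈LGen : ∀ {y r} → Even i → w ≤ i → 1 ≤ y → y < r →
           xp i y ⊗ xp (suc i) 1 ⊗ xp (2 + i) ((r ∸ y) ∸ 1) ∈⟨ LGen r w ⟩
ev2∈LGen {y = y} {r} i-even w≤i 1≤y y<r rewrite ∸-+-assoc r y 1 | +-comm y 1 =
  _ , LGen-ev2 i-even w≤i (∸-monoʳ-≤ r (s≤s 1≤y)) ,
  ⊗-mono-≼ (⊗-mono-≼ (xp-mono-≼ (≤-reflexive (cong (_∸ 1) (m∸[m∸n]≡n y<r)))) ≼-refl)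
           ≼-refl

ev1∈LGenEven : 1 ≤ r → ℓ ≤ r → n ≤ r ∸ 1 →
               xp i (r ∸ n) ⊗ xp (2 + i) n ∈⟨ LGenEven r ℓ i ⟩
ev1∈LGenEven {r} {ℓ} {n} 1≤r ℓ≤r n≤r∸1 with ℓ ≤? r ∸ n
... | yes ℓ≤r∸n = _ , e-pow , ≼-trans (xp-mono-≼ ℓ≤r∸n) e≼e⊗f
... | no  ℓ≰r∸n =
  ∈⟨⟩-≼ (LGenEven-t1 ℓ≤r (m<n⇒0<n∸m n<r) (≰⇒> ℓ≰r∸n))
        (⊗-mono-≼ ≼-refl (xp-mono-≼ (≤-reflexive (m∸[m∸n]≡n (<⇒≤ n<r)))))
  where n<r = ≤∸1⇒< 1≤r n≤r∸1

ev2∈LGenEven : 2 ≤ r → ℓ ≤ r → n ≤ r ∸ 2 →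
               xp i ((r ∸ n) ∸ 1) ⊗ xp (suc i) 1 ⊗ xp (2 + i) n ∈⟨ LGenEven r ℓ i ⟩
ev2∈LGenEven {r} {ℓ} {n} 2≤r ℓ≤r n≤r∸2
  rewrite ∸-+-assoc r n 1 | +-comm n 1 with ℓ ≤? r ∸ suc n
... | yes ℓ≤y = _ , e-pow , ≼-trans (xp-mono-≼ ℓ≤y) (≼-trans e≼e⊗f e≼e⊗f)
... | no  ℓ≰y =
  ∈⟨⟩-≼ (LGenEven-t2 ℓ≤r (m<n⇒0<n∸m 1+n<r) (≰⇒> ℓ≰y))
        (⊗-mono-≼ ≼-refl (xp-mono-≼ (≤-reflexive (cong (_∸ 1) (m∸[m∸n]≡n (<⇒≤ 1+n<r))))))
  where 1+n<r = ≤∸2⇒suc< 2≤r n≤r∸2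

LGen⊆LGenEven : 2 ≤ r → ℓ ≤ r → Even i → LGen r i e → e ∈⟨ LGenEven r ℓ i ⟩
LGen⊆LGenEven _ _ (c , refl) (g-sq a p) =
  ∈⟨⟩-gen (e-L (g-sq a (s≤s (even≤odd⇒even≤even c a p))))
LGen⊆LGenEven _ _ (c , refl) (g-odd b p) =
  ∈⟨⟩-gen (e-L (g-odd b (s≤s (even≤odd⇒even≤even c b p))))
LGen⊆LGenEven 2≤r ℓ≤r (c′ , refl) (g-ev1 c n p q) with double-≤-split c′ c p
... | inj₁ refl = ev1∈LGenEven (≤-trans (n≤1+n 1) 2≤r) ℓ≤r q
... | inj₂ p′   = ∈⟨⟩-gen (e-L (g-ev1 c n (<⇒≤ p′) q))
LGen⊆LGenEven 2≤r ℓ≤r (c′ , refl) (g-ev2 c n p q) with double-≤-split c′ c p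
... | inj₁ refl = ev2∈LGenEven 2≤r ℓ≤r q
... | inj₂ p′   = ∈⟨⟩-gen (e-L (g-ev2 c n (<⇒≤ p′) q))

LGen⊆LGenOdd : 2 ≤ r → ℓ ≤ r → Odd i → LGen r i e → e ∈⟨ LGenOdd r ℓ i ⟩
LGen⊆LGenOdd _ _ (m , refl) (g-sq a p) with double-≤-split m a (s≤s⁻¹ p)
... | inj₁ refl = _ , o-sq , ≼-refl
... | inj₂ p′   = ∈⟨⟩-gen (o-L (e-L (g-sq a (s≤s p′))))
LGen⊆LGenOdd _ ℓ≤r (m , refl) (g-odd b p) with double-≤-split m b (s≤s⁻¹ p)
... | inj₁ refl = _ , o-mix , ⊗-mono-≼ ≼-refl (xp-mono-≼ (∸-monoˡ-≤ 1 ℓ≤r))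
... | inj₂ p′   = ∈⟨⟩-gen (o-L (e-L (g-odd b (s≤s p′))))
LGen⊆LGenOdd 2≤r ℓ≤r i-odd@(m , refl) (g-ev1 c n p q) =
  ∈⟨⟩-map o-L (LGen⊆LGenEven 2≤r ℓ≤r (Odd⇒Even-suc i-odd)
                             (g-ev1 c n (odd<even⇒suc-odd≤even m c p) q))
LGen⊆LGenOdd 2≤r ℓ≤r i-odd@(m , refl) (g-ev2 c n p q) =
  ∈⟨⟩-map o-L (LGen⊆LGenEven 2≤r ℓ≤r (Odd⇒Even-suc i-odd)
                             (g-ev2 c n (odd<even⇒suc-odd≤even m c p) q))

xp-⊗-LGenOdd∈LGenEven : Even i → b < ℓ → ℓ ≤ r → LGenOdd r (r ∸ b) (suc i) f →
                        xp i b ⊗ f ∈⟨ LGenEven r ℓ i ⟩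
xp-⊗-LGenOdd∈LGenEven {i = i} {b = b} i-even _ _ o-sq =
  ∈⟨⟩-⊗ˡ (xp i b) (∈⟨⟩-map e-L (∈⟨⟩-gen (LGen-sq (Even⇒Odd-suc i-even) ≤-refl)))
xp-⊗-LGenOdd∈LGenEven {i = i} {b = zero} i-even _ _ o-mix =
  ∈⟨⟩-⊗ˡ (xp i 0) (∈⟨⟩-map e-L (∈⟨⟩-gen (LGen-odd (Even⇒Odd-suc i-even) ≤-refl)))
xp-⊗-LGenOdd∈LGenEven {i = i} {b = b@(suc _)} {r = r} _ b<ℓ ℓ≤r o-mix =
  ∈⟨⟩-≼ (LGenEven-t2 ℓ≤r (s≤s z≤n) b<ℓ)
        (⊗-assoc-≼ (xp i b) (xp (suc i) 1) (xp (2 + i) ((r ∸ b) ∸ 1)))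
xp-⊗-LGenOdd∈LGenEven {i = i} {b = zero} i-even _ _ (o-L e-pow) =
  ∈⟨⟩-⊗ˡ (xp i 0) (∈⟨⟩-map e-L
    (∈⟨⟩-≼ (∈⟨⟩-gen (LGen-ev1 (Even-2+ i-even) (n≤1+n _) z≤n)) ⊗-xp-0-≼))
xp-⊗-LGenOdd∈LGenEven {b = suc _} _ b<ℓ ℓ≤r (o-L e-pow) =
  LGenEven-t1 ℓ≤r (s≤s z≤n) b<ℓ
xp-⊗-LGenOdd∈LGenEven {i = i} {b = b} {r = r} i-even _ _ (o-L (e-t1 t 1≤t t≤ℓ′∸1)) =
  let 1≤y , y<ℓ′ , exponent≡ = t-generator-in-y-form (m∸n≤m r b) 1≤t t≤ℓ′∸1 in
  ∈⟨⟩-⊗ˡ (xp i b) (∈⟨⟩-map e-L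
    (∈⟨⟩-≼ (ev1∈LGen (Even-2+ i-even) (n≤1+n _) 1≤y (<⇒≤ (<-≤-trans y<ℓ′ (m∸n≤m r b))))
           (⊗-mono-≼ ≼-refl (xp-mono-≼ (≤-reflexive (sym exponent≡))))))
xp-⊗-LGenOdd∈LGenEven {i = i} {b = b} {r = r} i-even _ _ (o-L (e-t2 t 1≤t t≤ℓ′∸1)) =
  let 1≤y , y<ℓ′ , exponent≡ = t-generator-in-y-form (m∸n≤m r b) 1≤t t≤ℓ′∸1 in
  ∈⟨⟩-⊗ˡ (xp i b) (∈⟨⟩-map e-L
    (∈⟨⟩-≼ (ev2∈LGen (Even-2+ i-even) (n≤1+n _) 1≤y (<-≤-trans y<ℓ′ (m∸n≤m r b)))
           (⊗-mono-≼ ≼-refl (xp-mono-≼ (≤-reflexive (cong (_∸ 1) (sym exponent≡)))))))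
xp-⊗-LGenOdd∈LGenEven {i = i} {b = b} _ _ _ (o-L (e-L g)) =
  ∈⟨⟩-⊗ˡ (xp i b) (∈⟨⟩-map e-L (∈⟨⟩-gen (LGen-weaken (m≤n⇒m≤1+n (n≤1+n _)) g)))

expo-++ : ∀ v xs ys → expo v (xs ++ ys) ≡ expo v xs + expo v ys
expo-++ v []       ys = refl
expo-++ v (i ∷ xs) ys =
  trans (cong (xp v 1 i +_) (expo-++ v xs ys)) (sym (+-assoc (xp v 1 i) (expo v xs) (expo v ys)))

expo-replicate : ∀ v i a → expo v (replicate a i) ≡ xp i a v
expo-replicate v i a with v ≟ i
... | yes refl = trans (count-self a) (sym (xp-self v a))
  where
  count-self : ∀ a → expo v (replicate a v) ≡ a
  count-self zero    = refl
  count-self (suc a) = cong₂ _+_ (xp-self v 1) (count-self a)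
... | no  v≢i  = trans (count-other a) (sym (xp-≢ a v≢i))
  where
  count-other : ∀ a → expo v (replicate a i) ≡ 0
  count-other zero    = refl
  count-other (suc a) = cong₂ _+_ (xp-≢ 1 (≢-sym v≢i)) (count-other a)

block : ℕ → ℕ → ℕ → List ℕ → List ℕ
block k a b ys = replicate a k ++ replicate b (suc k) ++ ys

blockWeight : ℕ → ℕ → ℕ → ℕ
blockWeight k a b = a * k + suc k * b

exps-block : ∀ k a b ys v → expo v (block k a b ys) ≡ (xp k a ⊗ (xp (suc k) b ⊗ exps ys)) v
exps-block k a b ys v =
  trans (expo-++ v (replicate a k) _)
        (cong₂ _+_ (expo-replicate v k a)
                   (trans (expo-++ v (replicate b (suc k)) ys)
                          (cong (_+ expo v ys) (expo-replicate v (suc k) b))))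

IsMon-Above : IsMon w ys → Above w (exps ys)
IsMon-Above {w} (_ , w≤ys) {v} v<w = go w≤ys
  where
  go : ∀ {ys} → All (w ≤_) ys → expo v ys ≡ 0
  go []           = refl
  go (w≤i ∷ w≤ys) = cong₂ _+_ (xp-≢ 1 (>⇒≢ (<-≤-trans v<w w≤i))) (go w≤ys)

module _ {k ys} (mon : IsMon (2 + k) ys) (a b : ℕ) where

  expo-block-k : expo k (block k a b ys) ≡ a
  expo-block-k = begin
    expo k (block k a b ys)
      ≡⟨ exps-block k a b ys k ⟩
    xp k a k + (xp (suc k) b k + expo k ys)
      ≡⟨ cong₂ _+_ (xp-self k a)
                   (cong₂ _+_ (xp-≢ b (<⇒≢ (n<1+n k))) (IsMon-Above mon (m<n⇒m<1+n (n<1+n k)))) ⟩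
    a + 0
      ≡⟨ +-identityʳ a ⟩
    a ∎
    where open ≡-Reasoning

  expo-block-suc : expo (suc k) (block k a b ys) ≡ b
  expo-block-suc = begin
    expo (suc k) (block k a b ys)
      ≡⟨ exps-block k a b ys (suc k) ⟩
    xp k a (suc k) + (xp (suc k) b (suc k) + expo (suc k) ys)
      ≡⟨ cong₂ _+_ (xp-≢ a (>⇒≢ (n<1+n k)))
                   (cong₂ _+_ (xp-self (suc k) b) (IsMon-Above mon (n<1+n (suc k)))) ⟩
    b + 0
      ≡⟨ +-identityʳ b ⟩
    b ∎
    where open ≡-Reasoning

  expo-block-≥ : ∀ {v} → 2 + k ≤ v → expo v (block k a b ys) ≡ expo v ys
  expo-block-≥ {v} 2+k≤v = begin
    expo v (block k a b ys)
      ≡⟨ exps-block k a b ys v ⟩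
    xp k a v + (xp (suc k) b v + expo v ys)
      ≡⟨ cong₂ _+_ (xp-≢ a (>⇒≢ (<-≤-trans (m<n⇒m<1+n (n<1+n k)) 2+k≤v)))
                   (cong (_+ expo v ys) (xp-≢ b (>⇒≢ 2+k≤v))) ⟩
    expo v ys ∎
    where open ≡-Reasoning

  Above-≼-block : ∀ {g} → Above (2 + k) g → g ≼ exps (block k a b ys) → g ≼ exps ys
  Above-≼-block {g} g↑ g≼block v with 2 + k ≤? v
  ... | yes 2+k≤v = subst (g v ≤_) (expo-block-≥ 2+k≤v) (g≼block v)
  ... | no  2+k≰v = subst (_≤ expo v ys) (sym (g↑ (≰⇒> 2+k≰v))) z≤n

xp-⊗-exps≼exps-block : ∀ k a b ys → xp (suc k) b ⊗ exps ys ≼ exps (block k a b ys)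
xp-⊗-exps≼exps-block k a b ys v =
  subst ((xp (suc k) b ⊗ exps ys) v ≤_) (sym (exps-block k a b ys v)) (m≤n+m _ (xp k a v))

IsMon-replicate : ∀ c → IsMon (suc w) ys → IsMon w (replicate c w ++ ys)
IsMon-replicate {w} zero    (linked , w<ys) = linked , All.map (≤-trans (n≤1+n w)) w<ys
IsMon-replicate {w} (suc c) mon =
  let linked , w≤ = IsMon-replicate c mon in cons w≤ linked , ≤-refl ∷ w≤
  where
  cons : All (w ≤_) zs → Linked _≤_ zs → Linked _≤_ (w ∷ zs)
  cons []        _      = [-]
  cons (w≤z ∷ _) linked = w≤z ∷ linked

IsMon-split : IsMon w xs → ∃₂ λ c ys → IsMon (suc w) ys × xs ≡ replicate c w ++ ys
IsMon-split {xs = []} _ = 0 , [] , ([] , []) , refl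
IsMon-split {w} {i ∷ xs} (linked , w≤i ∷ w≤xs) with i ≟ w
... | yes refl = let c , ys , mon , xs≡ = IsMon-split (Linked.tail linked , w≤xs) in
                 suc c , ys , mon , cong (w ∷_) xs≡
... | no  i≢w  =
  0 , i ∷ xs , (linked , Linked⇒All ≤-trans (≤∧≢⇒< w≤i (≢-sym i≢w)) linked) , refl

block-decompose : IsMon k xs → ∃₂ λ a b → ∃ λ ys → IsMon (2 + k) ys × xs ≡ block k a b ys
block-decompose mon with IsMon-split mon
... | a , zs , mon′ , refl with IsMon-split mon′
...   | b , ys , mon″ , refl = a , b , ys , mon″ , refl

IsMon-block : ∀ a b → IsMon (2 + k) ys → IsMon k (block k a b ys)
IsMon-block a b mon = IsMon-replicate a (IsMon-replicate b mon)

block-cancel : ∀ k a b {ys ys′} → block k a b ys ≡ block k a b ys′ → ys ≡ ys′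
block-cancel k a b = ++-cancelˡ (replicate b (suc k)) _ _ ∘ ++-cancelˡ (replicate a k) _ _

sum-replicate : ∀ a i → sum (replicate a i) ≡ a * i
sum-replicate zero    i = refl
sum-replicate (suc a) i = cong (i +_) (sum-replicate a i)

weight-block : ∀ k a b ys → weight (block k a b ys) ≡ blockWeight k a b + weight ys
weight-block k a b ys = begin
  sum (replicate a k ++ replicate b (suc k) ++ ys)
    ≡⟨ sum-++ (replicate a k) _ ⟩
  sum (replicate a k) + sum (replicate b (suc k) ++ ys)
    ≡⟨ cong (sum (replicate a k) +_) (sum-++ (replicate b (suc k)) ys) ⟩
  sum (replicate a k) + (sum (replicate b (suc k)) + sum ys)
    ≡⟨ +-assoc (sum (replicate a k)) _ _ ⟨
  sum (replicate a k) + sum (replicate b (suc k)) + sum ys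
    ≡⟨ cong (_+ sum ys) (cong₂ _+_ (sum-replicate a k)
                                   (trans (sum-replicate b (suc k)) (*-comm b (suc k)))) ⟩
  blockWeight k a b + sum ys ∎
  where open ≡-Reasoning

-- (suc k * suc b) ∸ 1 reduces to b + k * (1 + b), so this is a semiring identity.
blockWeight-1 : ∀ k b → blockWeight k 1 b ≡ (suc k * suc b) ∸ 1
blockWeight-1 = semiring
  where
  semiring : ∀ k b → 1 * k + (1 + k) * b ≡ b + k * (1 + b)
  semiring = solve-∀

block-LGenOdd⇒LGenOdd : Odd k → 2 ≤ r → ℓ ≤ r → IsMon (2 + k) ys → a ≤ 1 → b < ℓ ∸ a →
                        LGenOdd r ℓ k e → e ≼ exps (block k a b ys) →
                        exps ys ∈⟨ LGenOdd r (r ∸ b) (2 + k) ⟩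
block-LGenOdd⇒LGenOdd {a = a} {b} _ _ _ mon a≤1 _ o-sq d =
  contradiction (subst (2 ≤_) (expo-block-k mon a b) (xp-≼⇒≤ d)) (≤⇒≯ a≤1)
block-LGenOdd⇒LGenOdd {a = a} {b} _ _ _ mon z≤n _ o-mix d =
  contradiction (subst (1 ≤_) (expo-block-k mon a b) (xp-≼⇒≤ (⊗-≼ˡ d))) λ ()
block-LGenOdd⇒LGenOdd {a = a} {b} _ _ _ mon (s≤s z≤n) b<ℓ∸1 o-mix d =
  contradiction (subst (_ ≤_) (expo-block-suc mon a b) (xp-≼⇒≤ (⊗-≼ʳ d))) (<⇒≱ b<ℓ∸1)
block-LGenOdd⇒LGenOdd {ℓ = ℓ} {a = a} {b} _ _ _ mon _ b<ℓ∸a (o-L e-pow) d =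
  contradiction (subst (ℓ ≤_) (expo-block-suc mon a b) (xp-≼⇒≤ d))
                (<⇒≱ (<-≤-trans b<ℓ∸a (m∸n≤m ℓ a)))
block-LGenOdd⇒LGenOdd {a = a} {b} _ _ ℓ≤r mon _ _ (o-L (e-t1 t _ t≤ℓ∸1)) d =
  _ , o-L e-pow , ≤⇒xp-≼ (≤-trans (n∸o≤p⇒m∸p≤[m∸n]+o t≤ℓ ℓ≤r ℓ∸t≤b) high)
  where
  t≤ℓ   = ≤-trans t≤ℓ∸1 (m∸n≤m _ 1)
  ℓ∸t≤b = subst (_ ≤_) (expo-block-suc mon a b) (xp-≼⇒≤ (⊗-≼ˡ d))
  high  = subst (_ ≤_) (expo-block-≥ mon a b (n≤1+n _)) (xp-≼⇒≤ (⊗-≼ʳ d))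
block-LGenOdd⇒LGenOdd {k} {ℓ = ℓ} {ys} {a} {b} _ _ ℓ≤r mon _ _ (o-L (e-t2 t _ t≤ℓ∸1)) d =
  _ , o-mix ,
  ⊗-xp-≼ (≤⇒xp-≼ one) (xp-≢ 1 (>⇒≢ (n<1+n (2 + k))))
         (≤-trans (∸-monoˡ-≤ 1 (n∸o≤p⇒m∸p≤[m∸n]+o t≤ℓ ℓ≤r ℓ∸t≤b)) high)
  where
  t≤ℓ   = ≤-trans t≤ℓ∸1 (m∸n≤m ℓ 1)
  d₁₂ : xp (suc k) (ℓ ∸ t) ⊗ xp (2 + k) 1 ≼ exps (block k a b ys)
  d₁₂ = ⊗-≼ˡ d
  ℓ∸t≤b = subst (_ ≤_) (expo-block-suc mon a b) (xp-≼⇒≤ (⊗-≼ˡ d₁₂))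
  one : 1 ≤ expo (2 + k) ys
  one   = subst (_ ≤_) (expo-block-≥ mon a b ≤-refl) (xp-≼⇒≤ (⊗-≼ʳ d₁₂))
  high  = subst (_ ≤_) (expo-block-≥ mon a b (n≤1+n _)) (xp-≼⇒≤ (⊗-≼ʳ d))
block-LGenOdd⇒LGenOdd {r = r} {a = a} {b} k-odd 2≤r _ mon _ _ (o-L (e-L g)) d =
  ∈⟨⟩-≼ (LGen⊆LGenOdd 2≤r (m∸n≤m r b) (Odd-2+ k-odd) g)
        (Above-≼-block mon a b (LGen-Above g) d)

block-InIdeal⇔ : Odd k → 2 ≤ r → ℓ ≤ r → IsMon (2 + k) ys → a ≤ 1 → b < ℓ ∸ a →
                 InIdeal (LGenOdd r ℓ k) (block k a b ys) ⇔ InIdeal (LGenOdd r (r ∸ b) (2 + k)) ys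
block-InIdeal⇔ {k} {r} {ℓ} {ys} {a} {b} k-odd 2≤r ℓ≤r mon a≤1 b<ℓ∸a = mk⇔
  (λ (_ , Ge , e≼block) → block-LGenOdd⇒LGenOdd k-odd 2≤r ℓ≤r mon a≤1 b<ℓ∸a Ge e≼block)
  (λ (_ , Gf , f≼ys) →
    ∈⟨⟩-≼ (∈⟨⟩-map o-L (xp-⊗-LGenOdd∈LGenEven (Odd⇒Even-suc k-odd) b<ℓ ℓ≤r Gf))
          (≼-trans (⊗-mono-≼ ≼-refl f≼ys) (xp-⊗-exps≼exps-block k a b ys)))
  where b<ℓ = <-≤-trans b<ℓ∸a (m∸n≤m ℓ a)

block∉⇒bounds : IsMon (2 + k) ys → ¬ InIdeal (LGenOdd r ℓ k) (block k a b ys) →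
                a ≤ 1 × b < ℓ ∸ a
block∉⇒bounds {a = a@(suc (suc _))} {b} mon ∉ =
  contradiction (_ , o-sq , ≤⇒xp-≼ (subst (2 ≤_) (sym (expo-block-k mon a b)) (s≤s (s≤s z≤n)))) ∉
block∉⇒bounds {ℓ = ℓ} {a = zero} {b} mon ∉ with ℓ ≤? b
... | yes ℓ≤b =
  contradiction (_ , o-L e-pow , ≤⇒xp-≼ (subst (ℓ ≤_) (sym (expo-block-suc mon 0 b)) ℓ≤b)) ∉
... | no  ℓ≰b = z≤n , ≰⇒> ℓ≰b
block∉⇒bounds {k} {ℓ = ℓ} {a = suc zero} {b} mon ∉ with ℓ ∸ 1 ≤? b
... | yes ℓ∸1≤b =
  contradiction (_ , o-mix , ⊗-xp-≼ (≤⇒xp-≼ (≤-reflexive (sym (expo-block-k mon 1 b))))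
                                    (xp-≢ 1 (>⇒≢ (n<1+n k)))
                                    (subst (ℓ ∸ 1 ≤_) (sym (expo-block-suc mon 1 b)) ℓ∸1≤b)) ∉
... | no  ℓ∸1≰b = s≤s z≤n , ≰⇒> ℓ∸1≰b

-- IsHP w G h is definitionally ∀ n → HasCount (Standard w G n) (h n).
Standard : ℕ → (Exp → Set) → ℕ → List ℕ → Set
Standard w G n xs = IsMon w xs × weight xs ≡ n × ¬ InIdeal G xs

module _ {k r ℓ : ℕ} (k-odd : Odd k) (2≤r : 2 ≤ r) (ℓ≤r : ℓ ≤ r) (n : ℕ) where

  Block : ℕ → ℕ → List ℕ → Set
  Block a b xs = ∃ λ ys →
    (blockWeight k a b ≤ n × Standard (2 + k) (LGenOdd r (r ∸ b) (2 + k)) (n ∸ blockWeight k a b) ys) ×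
    xs ≡ block k a b ys

  Blocks : List ℕ → Set
  Blocks xs = (∃ λ b → b < ℓ ∸ 1 × Block 1 b xs) ⊎ (∃ λ b → b < ℓ × Block 0 b xs)

  Standard-block⇔ : ∀ {ys a b} → IsMon (2 + k) ys → a ≤ 1 → b < ℓ ∸ a →
    Standard k (LGenOdd r ℓ k) n (block k a b ys) ⇔
    (blockWeight k a b ≤ n × Standard (2 + k) (LGenOdd r (r ∸ b) (2 + k)) (n ∸ blockWeight k a b) ys)
  Standard-block⇔ {ys} {a} {b} mon a≤1 b<ℓ∸a = mk⇔
    (λ (_ , weight≡n , ∉) →
      let s≤n , weight′ = to weight⇔ (trans (sym (weight-block k a b ys)) weight≡n) in
      s≤n , mon , weight′ , ∉ ∘ from ideal⇔)
    (λ (s≤n , _ , weight′ , ∉) →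
      IsMon-block a b mon ,
      trans (weight-block k a b ys) (from weight⇔ (s≤n , weight′)) ,
      ∉ ∘ to ideal⇔)
    where
    weight⇔ = m+n≡o⇔m≤o×n≡o∸m (blockWeight k a b) (weight ys) n
    ideal⇔  = block-InIdeal⇔ k-odd 2≤r ℓ≤r mon a≤1 b<ℓ∸a

  Standard⇔Blocks : ∀ xs → Standard k (LGenOdd r ℓ k) n xs ⇔ Blocks xs
  Standard⇔Blocks xs = mk⇔ split join
    where
    split : Standard k (LGenOdd r ℓ k) n xs → Blocks xs
    split std@(mon , _ , ∉) with block-decompose mon
    ... | a , b , ys , mon′ , refl with block∉⇒bounds {r = r} {ℓ} {a} {b} mon′ ∉
    ...   | z≤n     , b<ℓ   = inj₂ (b , b<ℓ , ys , to (Standard-block⇔ mon′ z≤n b<ℓ) std , refl)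
    ...   | s≤s z≤n , b<ℓ∸1 =
      inj₁ (b , b<ℓ∸1 , ys , to (Standard-block⇔ mon′ (s≤s z≤n) b<ℓ∸1) std , refl)
    join : Blocks xs → Standard k (LGenOdd r ℓ k) n xs
    join (inj₁ (_ , b<ℓ∸1 , _ , std@(_ , mon , _) , refl)) =
      from (Standard-block⇔ mon (s≤s z≤n) b<ℓ∸1) std
    join (inj₂ (_ , b<ℓ , _ , std@(_ , mon , _) , refl)) =
      from (Standard-block⇔ mon z≤n b<ℓ) std

  Block-unique : ∀ {a b a′ b′ xs} → Block a b xs → Block a′ b′ xs → a ≡ a′ × b ≡ b′
  Block-unique {a} {b} {a′} {b′} (_ , (_ , mon , _) , refl) (_ , (_ , mon′ , _) , xs≡) =
    trans (sym (expo-block-k mon a b)) (trans (cong (expo k) xs≡) (expo-block-k mon′ a′ b′)) ,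
    trans (sym (expo-block-suc mon a b)) (trans (cong (expo (suc k)) xs≡) (expo-block-suc mon′ a′ b′))

  Block-count : ∀ a b {h} → IsHP (2 + k) (LGenOdd r (r ∸ b) (2 + k)) h →
                HasCount (Block a b) (shift (blockWeight k a b) h n)
  Block-count a b hp = HasCount-image (block-cancel k a b) (HasCount-shift hp (blockWeight k a b) n)

  Standard-count : (H : ℕ → ℕ → ℕ) →
    (∀ ℓ′ → 1 ≤ ℓ′ → ℓ′ ≤ r → IsHP (2 + k) (LGenOdd r ℓ′ (2 + k)) (H ℓ′)) →
    HasCount (Standard k (LGenOdd r ℓ k) n)
      (sum1 (ℓ ∸ 1) (λ j → shift ((suc k * j) ∸ 1) (H ((r ∸ j) + 1)) n)
       + sum1 ℓ (λ j → shift (suc k * (j ∸ 1)) (H ((r ∸ j) + 1)) n))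
  Standard-count H H-HP = HasCount-cong (λ xs → ⇔-sym (Standard⇔Blocks xs))
    (HasCount-⊎ (λ { _ (_ , _ , B₁) (_ , _ , B₀) → 1+n≢0 (proj₁ (Block-unique {1} {a′ = 0} B₁ B₀)) })
      (HasCount-sum1 (ℓ ∸ 1) (λ B B′ → proj₂ (Block-unique {1} {a′ = 1} B B′)) count₁)
      (HasCount-sum1 ℓ (λ B B′ → proj₂ (Block-unique {0} {a′ = 0} B B′))
                     (λ b b<ℓ → Block-count 0 b (IsHP-r∸b b (<-≤-trans b<ℓ ℓ≤r)))))
    where
    IsHP-r∸b : ∀ b → b < r → IsHP (2 + k) (LGenOdd r (r ∸ b) (2 + k)) (H ((r ∸ suc b) + 1))
    IsHP-r∸b b b<r =
      subst (λ ℓ′ → IsHP (2 + k) (LGenOdd r ℓ′ (2 + k)) (H ((r ∸ suc b) + 1))) ℓ′≡r∸b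
            (H-HP _ (m≤n+m 1 _) (≤-trans (≤-reflexive ℓ′≡r∸b) (m∸n≤m r b)))
      where ℓ′≡r∸b = trans (+-comm _ 1) (sym (+-∸-assoc 1 b<r))
    count₁ : ∀ b → b < ℓ ∸ 1 →
             HasCount (Block 1 b) (shift ((suc k * suc b) ∸ 1) (H ((r ∸ suc b) + 1)) n)
    count₁ b b<ℓ∸1 =
      subst (HasCount (Block 1 b)) (cong (λ s → shift s (H ((r ∸ suc b) + 1)) n) (blockWeight-1 k b))
            (Block-count 1 b (IsHP-r∸b b (<-≤-trans b<ℓ∸1 (≤-trans (m∸n≤m ℓ 1) ℓ≤r))))

lemma2p1 : (J k r ℓ : ℕ) → 2 ≤ r → 1 ≤ ℓ → ℓ ≤ r →
    Odd k → suc (2 * J) ≤ k →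
    (h : ℕ → ℕ) → IsHP k (LGenℓ r ℓ k) h →
    (H : ℕ → ℕ → ℕ) →
    (∀ ℓ′ → 1 ≤ ℓ′ → ℓ′ ≤ r → IsHP (2 + k) (LGenℓ r ℓ′ (2 + k)) (H ℓ′)) →
    ∀ n → h n ≡ sum1 (ℓ ∸ 1) (λ j → shift ((suc k * j) ∸ 1) (H ((r ∸ j) + 1)) n)
                + sum1 ℓ (λ j → shift (suc k * (j ∸ 1)) (H ((r ∸ j) + 1)) n)
lemma2p1 _ k r ℓ 2≤r _ ℓ≤r k-odd _ h h-HP H H-HP n =
  HasCount-unique (IsHP-odd k-odd h-HP n)
    (Standard-count k-odd 2≤r ℓ≤r n H
       λ ℓ′ 1≤ℓ′ ℓ′≤r → IsHP-odd (Odd-2+ k-odd) (H-HP ℓ′ 1≤ℓ′ ℓ′≤r))
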